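{- Let $n,k$ be positive integers with $k\geq 2$, and let $\vec{s}=(s_1,\dots,s_k)$ be a vector of positive integers with $n\geq\sum_{i=1}^{k}s_i$ and $s_k\leq 2\min\{s_i : 1\leq i\leq k-1\}$. Then \[ \chi\left(\mathrm{KG}^{2}(n,k)_{\vec{s}\textup{ -stab}}\right) \leq n - \sum_{i=1}^{k-1}s_i - \max\{0, s_k-\min\{s_1,\dots,s_{k-1}\}\}. \]
   Context: For a positive integer $n$, $[n]=\{1,\dots,n\}$. For a $k$-subset $A\subseteq[n]$, let $A(1)<\dots<A(k)$ be its elements in increasing order. For a vector $\vec{s}=(s_1,\dots,s_k)$ of positive integers, $A$ is $\vec{s}$-stable if $A(j+1)-A(j)\geq s_j$ for $1\leq j\leq k-1$ and $A(k)-A(1)\leq n-s_k$. The graph $\mathrm{KG}^{2}(n,k)_{\vec{s}\textup{ -stab}}$ has as vertices all $\vec{s}$-stable $k$-subsets of $[n]$, two vertices adjacent iff disjoint. $\chi$ denotes the chromatic number. -}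

module Defs where

open import Data.Nat using (ℕ; zero; suc; _+_; _∸_; _≤_; _<_; _⊓_)
open import Data.Fin using (Fin; zero; suc; toℕ; fromℕ; inject₁)
open import Data.Product using (Σ; _×_; ∃)
open import Relation.Binary.PropositionalEquality using (_≡_; _≢_)

-- A k-subset of [n] is represented by its elements listed in increasing
-- order: A : Fin k → ℕ, with A i = A(i+1) in the paper's 1-based notation.
-- Throughout k = suc p (so the last index is fromℕ p).

sumFin : ∀ {j} → (Fin j → ℕ) → ℕ
sumFin {zero}  f = 0
sumFin {suc j} f = f zero + sumFin (λ i → f (suc i))

minFin : ∀ {j} → (Fin (suc j) → ℕ) → ℕ
minFin {zero}  f = f zero
minFin {suc j} f = f zero ⊓ minFin (λ i → f (suc i))

IsKSubset : (n p : ℕ) → (Fin (suc p) → ℕ) → Set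
IsKSubset n p A =
  (1 ≤ A zero) × (A (fromℕ p) ≤ n) × ((i : Fin p) → A (inject₁ i) < A (suc i))

-- s-stability: A(j+1) - A(j) ≥ s_j for 1 ≤ j ≤ k-1, and A(k) - A(1) ≤ n - s_k
IsStable : (n p : ℕ) → (s : Fin (suc p) → ℕ) → (Fin (suc p) → ℕ) → Set
IsStable n p s A =
  ((i : Fin p) → A (inject₁ i) + s (inject₁ i) ≤ A (suc i))
  × (A (fromℕ p) + s (fromℕ p) ≤ n + A zero)

StabVertex : (n p : ℕ) → (Fin (suc p) → ℕ) → Set
StabVertex n p s = Σ (Fin (suc p) → ℕ) (λ A → IsKSubset n p A × IsStable n p s A)

Disjoint : ∀ {p} → (A B : Fin (suc p) → ℕ) → Set
Disjoint A B = ∀ i j → A i ≢ B j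

ProperColouring : (n p : ℕ) → (s : Fin (suc p) → ℕ) → (c : ℕ) → Set
ProperColouring n p s c =
  Σ (StabVertex n p s → Fin c) (λ col →
    (u v : StabVertex n p s) → Disjoint (Data.Product.proj₁ u) (Data.Product.proj₁ v) →
      col u ≢ col v)

ChromaticAtMost : (n p : ℕ) → (s : Fin (suc p) → ℕ) → (c : ℕ) → Set
ChromaticAtMost n p s c = ProperColouring n p s c

{-# OPTIONS --safe #-}
module Submission where

open import Defs
open import Data.Nat using (ℕ; zero; suc; _+_; _∸_; _*_; _≤_; _<_; _⊔_; s≤s; _≤?_)
open import Data.Nat.Properties
open import Data.Nat.Solver using (module +-*-Solver)
open import Data.Fin using (Fin; zero; suc; fromℕ; inject₁; toℕ; fromℕ<)
open import Data.Fin.Properties using (toℕ-fromℕ<)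
open import Data.Product using (∃; _×_; _,_; proj₁; proj₂)
open import Data.Sum using (_⊎_; inj₁; inj₂; [_,_])
open import Data.Empty using (⊥-elim)
open import Function using (_∘_)
open import Relation.Nullary using (yes; no)
open import Relation.Binary.PropositionalEquality using (_≡_; _≢_; refl; sym; trans; cong; subst)
open +-*-Solver using (solve; _:+_; _:=_)
open ≤-Reasoning

-- Pick j with s_j minimal among s_1, …, s_{k-1}, put P = s_1 + … + s_j and
-- d = max(0, s_k - s_j), and consider the window W = {P+1, …, n - d - (s_{j+1} + … + s_{k-1})},
-- of exactly n - (s_1 + … + s_{k-1}) - d elements.  Every stable set A meets W:
-- A(j+1) ≥ A(1) + P > P, and if A(j+1) lies beyond W, then A(k) > n - d, so the
-- wrap-around condition A(k) + s_k ≤ n + A(1) forces A(1) > s_j and hence A(j) > P,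
-- while s_k ≤ 2 s_j (that is, d ≤ s_j) keeps A(j) inside W.  Colouring A by the
-- position in W of one of its elements is proper, as equally coloured sets intersect.

sumBefore : ∀ {p} → (Fin p → ℕ) → Fin p → ℕ
sumBefore g zero    = 0
sumBefore g (suc j) = g zero + sumBefore (g ∘ suc) j

sumAfter : ∀ {p} → (Fin p → ℕ) → Fin p → ℕ
sumAfter g zero    = sumFin (g ∘ suc)
sumAfter g (suc j) = sumAfter (g ∘ suc) j

sumBefore+at+sumAfter : ∀ {p} (g : Fin p → ℕ) j → sumBefore g j + g j + sumAfter g j ≡ sumFin g
sumBefore+at+sumAfter g zero    = refl
sumBefore+at+sumAfter g (suc j) = begin-equality
  g zero + b + x + a     ≡⟨ cong (_+ a) (+-assoc (g zero) b x) ⟩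
  g zero + (b + x) + a   ≡⟨ +-assoc (g zero) (b + x) a ⟩
  g zero + (b + x + a)   ≡⟨ cong (g zero +_) (sumBefore+at+sumAfter (g ∘ suc) j) ⟩
  sumFin g               ∎
  where
  b x a : ℕ
  b = sumBefore (g ∘ suc) j
  x = g (suc j)
  a = sumAfter (g ∘ suc) j

sumFin-init+last : ∀ {p} (s : Fin (suc p) → ℕ) → sumFin s ≡ sumFin (s ∘ inject₁) + s (fromℕ p)
sumFin-init+last {zero}  s = +-identityʳ (s zero)
sumFin-init+last {suc p} s = begin-equality
  s zero + sumFin (s ∘ suc)                                  ≡⟨ cong (s zero +_) (sumFin-init+last (s ∘ suc)) ⟩
  s zero + (sumFin (s ∘ suc ∘ inject₁) + s (fromℕ (suc p)))  ≡⟨ +-assoc (s zero) _ _ ⟨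
  s zero + sumFin (s ∘ suc ∘ inject₁) + s (fromℕ (suc p))    ∎

minFin-attained : ∀ {p} (f : Fin (suc p) → ℕ) → ∃ λ i → f i ≡ minFin f
minFin-attained {zero}  f = zero , refl
minFin-attained {suc p} f with ⊓-sel (f zero) (minFin (f ∘ suc))
... | inj₁ min≡f0 = zero , sym min≡f0
... | inj₂ min≡minTail with minFin-attained (f ∘ suc)
...   | i , fi≡minTail = suc i , trans fi≡minTail (sym min≡minTail)

Gapped : ∀ {p} → (Fin (suc p) → ℕ) → (Fin p → ℕ) → Set
Gapped f g = ∀ i → f (inject₁ i) + g i ≤ f (suc i)

module _ {p} (f : Fin (suc (suc p)) → ℕ) (g : Fin (suc p) → ℕ) (gap : Gapped f g) where

  gapped-tail : Gapped (f ∘ suc) (g ∘ suc)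
  gapped-tail = gap ∘ suc

  gapped-step : ∀ {x y} → f (suc zero) + x ≤ y → f zero + (g zero + x) ≤ y
  gapped-step {x} {y} f1+x≤y = begin
    f zero + (g zero + x)   ≡⟨ +-assoc (f zero) (g zero) x ⟨
    f zero + g zero + x     ≤⟨ +-monoˡ-≤ x (gap zero) ⟩
    f (suc zero) + x        ≤⟨ f1+x≤y ⟩
    y                       ∎

gapped-sumFin : ∀ {p} (f : Fin (suc p) → ℕ) (g : Fin p → ℕ) → Gapped f g →
                f zero + sumFin g ≤ f (fromℕ p)
gapped-sumFin {zero}  f g gap = ≤-reflexive (+-identityʳ (f zero))
gapped-sumFin {suc p} f g gap =
  gapped-step f g gap (gapped-sumFin (f ∘ suc) (g ∘ suc) (gapped-tail f g gap))

gapped-sumBefore : ∀ {p} (f : Fin (suc p) → ℕ) (g : Fin p → ℕ) → Gapped f g →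
                   ∀ j → f zero + sumBefore g j ≤ f (inject₁ j)
gapped-sumBefore f g gap zero    = ≤-reflexive (+-identityʳ (f zero))
gapped-sumBefore f g gap (suc j) =
  gapped-step f g gap (gapped-sumBefore (f ∘ suc) (g ∘ suc) (gapped-tail f g gap) j)

gapped-sumAfter : ∀ {p} (f : Fin (suc p) → ℕ) (g : Fin p → ℕ) → Gapped f g →
                  ∀ j → f (suc j) + sumAfter g j ≤ f (fromℕ p)
gapped-sumAfter f g gap zero    = gapped-sumFin (f ∘ suc) (g ∘ suc) (gapped-tail f g gap)
gapped-sumAfter f g gap (suc j) = gapped-sumAfter (f ∘ suc) (g ∘ suc) (gapped-tail f g gap) j

InWindow : ℕ → ℕ → ℕ → Set
InWindow P c e = P < e × e ≤ P + c

window-offset : ∀ {P c e} → InWindow P c e → Fin c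
window-offset {P} {c} {e} (P<e , e≤P+c) =
  fromℕ< (subst (e ∸ suc P <_) (m+n∸m≡n P c) (∸-monoˡ-< (s≤s e≤P+c) P<e))

window-offset-injective : ∀ {P c e e′} (e∈W : InWindow P c e) (e′∈W : InWindow P c e′) →
                          window-offset e∈W ≡ window-offset e′∈W → e ≡ e′
window-offset-injective (P<e , _) (P<e′ , _) same =
  ∸-cancelʳ-≡ P<e P<e′ (trans (sym (toℕ-fromℕ< _)) (trans (cong toℕ same) (toℕ-fromℕ< _)))

meets-window⇒colouring : ∀ {n p s} P c →
  ((u : StabVertex n p s) → ∃ λ i → InWindow P c (proj₁ u i)) → ChromaticAtMost n p s c
meets-window⇒colouring {n} {p} {s} P c meets = colour , proper
  where
  colour : StabVertex n p s → Fin c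
  colour u = window-offset (proj₂ (meets u))

  proper : (u v : StabVertex n p s) → Disjoint (proj₁ u) (proj₁ v) → colour u ≢ colour v
  proper u v disjoint same = disjoint (proj₁ (meets u)) (proj₁ (meets v))
    (window-offset-injective (proj₂ (meets u)) (proj₂ (meets v)) same)

-- For a stable A, the variables a, x, y, L stand for A(1), A(j), A(j+1), A(k), and
-- q, t, r for s_1 + … + s_{j-1}, s_j, s_{j+1} + … + s_{k-1}.
pair-meets-window : ∀ {a x y L n q t r c d sk} →
  0 < a → a + q ≤ x → x + t ≤ y → y + r ≤ L → L ≤ n → L + sk ≤ n + a →
  q + t + c + r + d ≡ n → d ≤ t → d ≡ 0 ⊎ sk ≡ t + d →
  InWindow (q + t) c x ⊎ InWindow (q + t) c y
pair-meets-window {a} {x} {y} {L} {n} {q} {t} {r} {c} {d} {sk}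
                  0<a a+q≤x x+t≤y y+r≤L L≤n wrap n≡ d≤t d-cases
  with y ≤? q + t + c
... | yes y≤E = inj₂ (P<y , y≤E)
  where
  P<y : q + t < y
  P<y = begin-strict
    q + t        <⟨ +-monoˡ-< t (+-monoˡ-< q 0<a) ⟩
    a + q + t    ≤⟨ +-monoˡ-≤ t a+q≤x ⟩
    x + t        ≤⟨ x+t≤y ⟩
    y            ∎
... | no y≰E = inj₁ (P<x , x≤E)
  where
  E : ℕ
  E = q + t + c

  x≤E : x ≤ E
  x≤E = +-cancelʳ-≤ (t + r) x E (begin
    x + (t + r)   ≡⟨ +-assoc x t r ⟨
    x + t + r     ≤⟨ +-monoˡ-≤ r x+t≤y ⟩
    y + r         ≤⟨ y+r≤L ⟩
    L             ≤⟨ L≤n ⟩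
    n             ≡⟨ n≡ ⟨
    E + r + d     ≤⟨ +-monoʳ-≤ (E + r) d≤t ⟩
    E + r + t     ≡⟨ +-assoc E r t ⟩
    E + (r + t)   ≡⟨ cong (E +_) (+-comm r t) ⟩
    E + (t + r)   ∎)

  n<L+d : n < L + d
  n<L+d = begin-strict
    n           ≡⟨ n≡ ⟨
    E + r + d   <⟨ +-monoˡ-< d (+-monoˡ-< r (≰⇒> y≰E)) ⟩
    y + r + d   ≤⟨ +-monoˡ-≤ d y+r≤L ⟩
    L + d       ∎

  t<a : t < a
  t<a = [ ⊥-elim ∘ d≢0 , wrap⇒t<a ] d-cases
    where
    d≢0 : d ≢ 0
    d≢0 d≡0 = <⇒≱ n<L+d (begin
      L + d   ≡⟨ cong (L +_) d≡0 ⟩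
      L + 0   ≡⟨ +-identityʳ L ⟩
      L       ≤⟨ L≤n ⟩
      n       ∎)

    wrap⇒t<a : sk ≡ t + d → t < a
    wrap⇒t<a sk≡t+d = +-cancelˡ-< n t a (begin-strict
      n + t         <⟨ +-monoˡ-< t n<L+d ⟩
      L + d + t     ≡⟨ +-assoc L d t ⟩
      L + (d + t)   ≡⟨ cong (L +_) (trans (+-comm d t) (sym sk≡t+d)) ⟩
      L + sk        ≤⟨ wrap ⟩
      n + a         ∎)

  P<x : q + t < x
  P<x = begin-strict
    q + t   ≡⟨ +-comm q t ⟩
    t + q   <⟨ +-monoˡ-< q t<a ⟩
    a + q   ≤⟨ a+q≤x ⟩
    x       ∎

m∸n≡0⊎m≡n+[m∸n] : ∀ m n → m ∸ n ≡ 0 ⊎ m ≡ n + (m ∸ n)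
m∸n≡0⊎m≡n+[m∸n] m n with ≤-total m n
... | inj₁ m≤n = inj₁ (m≤n⇒m∸n≡0 m≤n)
... | inj₂ n≤m = inj₂ (sym (m+[n∸m]≡n n≤m))

stable-colouring-at : ∀ {n p} (s : Fin (suc p) → ℕ) (j : Fin p) →
  sumFin s ≤ n → s (fromℕ p) ≤ 2 * s (inject₁ j) →
  ChromaticAtMost n p s (n ∸ sumFin (s ∘ inject₁) ∸ (s (fromℕ p) ∸ s (inject₁ j)))
stable-colouring-at {n} {p} s j sum≤n sk≤2t = meets-window⇒colouring {s = s} (q + t) c meets
  where
  g : Fin p → ℕ
  g = s ∘ inject₁

  q t r S sk d c : ℕ
  q  = sumBefore g j
  t  = g j
  r  = sumAfter g j
  S  = sumFin g
  sk = s (fromℕ p)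
  d  = sk ∸ t
  c  = n ∸ S ∸ d

  d≤t : d ≤ t
  d≤t = m≤n+o⇒m∸n≤o sk t (subst (λ e → sk ≤ t + e) (+-identityʳ t) sk≤2t)

  S+d≤n : S + d ≤ n
  S+d≤n = begin
    S + d      ≤⟨ +-monoʳ-≤ S (m∸n≤m sk t) ⟩
    S + sk     ≡⟨ sumFin-init+last s ⟨
    sumFin s   ≤⟨ sum≤n ⟩
    n          ∎

  n≡ : q + t + c + r + d ≡ n
  n≡ = begin-equality
    q + t + c + r + d        ≡⟨ solve 5 (λ q t c r d → q :+ t :+ c :+ r :+ d := q :+ t :+ r :+ d :+ c) refl q t c r d ⟩
    q + t + r + d + c        ≡⟨ cong (λ e → e + d + c) (sumBefore+at+sumAfter g j) ⟩
    S + d + c                ≡⟨ cong (S + d +_) (∸-+-assoc n S d) ⟩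
    S + d + (n ∸ (S + d))    ≡⟨ m+[n∸m]≡n S+d≤n ⟩
    n                        ∎

  meets : (u : StabVertex n p s) → ∃ λ i → InWindow (q + t) c (proj₁ u i)
  meets (A , (0<a , L≤n , _) , gap , wrap)
    with pair-meets-window 0<a (gapped-sumBefore A g gap j) (gap j) (gapped-sumAfter A g gap j)
                           L≤n wrap n≡ d≤t (m∸n≡0⊎m≡n+[m∸n] sk t)
  ... | inj₁ A[j]∈W   = inject₁ j , A[j]∈W
  ... | inj₂ A[j+1]∈W = suc j , A[j+1]∈W

lemma3 : (n m : ℕ) → 1 ≤ n → (s : Fin (suc (suc m)) → ℕ) →
    ((i : Fin (suc (suc m))) → 1 ≤ s i) →
    sumFin s ≤ n →
    s (fromℕ (suc m)) ≤ 2 * minFin (λ (i : Fin (suc m)) → s (inject₁ i)) →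
    ChromaticAtMost n (suc m) s
      (n ∸ sumFin (λ (i : Fin (suc m)) → s (inject₁ i))
         ∸ (0 ⊔ (s (fromℕ (suc m)) ∸ minFin (λ (i : Fin (suc m)) → s (inject₁ i)))))
lemma3 n m _ s _ sum≤n sk≤2min with minFin-attained (s ∘ inject₁)
... | j , sj≡min =
  -- `0 ⊔ x` reduces to `x`.
  subst (λ t → ChromaticAtMost n (suc m) s (n ∸ sumFin (s ∘ inject₁) ∸ (sk ∸ t))) sj≡min
    (stable-colouring-at s j sum≤n (subst (λ t → sk ≤ 2 * t) (sym sj≡min) sk≤2min))
  where
  sk : ℕ
  sk = s (fromℕ (suc m))
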